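{- Let $\Gamma$ be a generalized circular ladder with at least one rung or a generalized Möbius ladder with at least two rungs, and let $e$ be a rung of $\Gamma$. Then $\Gamma$ admits a nowhere-zero $3$-flow if and only if $\Gamma-e$ does not admit any nowhere-zero $3$-flow.
   Context: Graphs are finite, undirected and loopless, with parallel edges allowed. A $k$-flow in a graph $\Gamma$ is a pair $(D,\varphi)$ where $D$ is an orientation and $\varphi$ assigns an integer to each arc with $|\varphi(e)|<k$ and with flow conservation at every vertex; it is nowhere-zero if $\varphi$ never vanishes. For $n\ge2$, the circular ladder $CL_n$ is the Cayley graph of $\mathbb{Z}_n\times\mathbb{Z}_2$ with connection set $\{(1,0),(-1,0),(0,1)\}$ (for $n=2$, $(1,0)=(-1,0)$ counted twice, giving parallel edges); its rungs are the edges $\{(i,0),(i,1)\}$ and its other $2n$ edges are rail edges. The Möbius ladder $M_n$ ($n\ge2$) is the Cayley graph of $\mathbb{Z}_{2n}$ with connection set $\{1,-1,n\}$; its rungs are the edges $\{i,i+n\}$ and its other $2n$ edges are rail edges. A generalized circular (resp. Möbius) ladder with $n\ge2$ rungs is a graph obtained from $CL_n$ (resp. $M_n$) by replacing each rail edge by a path of length at least one; the edges of these paths are rail edges and the rungs remain rungs. By convention: deleting one rung of a generalized circular ladder with two rungs gives a graph consisting of two vertex-disjoint cycles $C_m,C_n$ ($m,n\ge2$) plus one edge joining them, regarded as a generalized circular ladder with one rung (that edge); deleting both rungs gives the disjoint union of two cycles, regarded as one with $0$ rungs. Likewise deleting one (resp. both) rungs of a generalized Möbius ladder with two rungs gives a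 cycle $C_n$ ($n\ge4$) plus a chord $e$ joining two non-consecutive vertices (resp. a cycle $C_n$), regarded as a generalized Möbius ladder with one rung $e$ (resp. $0$ rungs). -}

module Defs where

open import Data.Nat using (ℕ; zero; suc; _<_; _+_; _%_)
open import Data.Nat.DivMod using (m%n<n)
open import Data.Integer using (ℤ; 0ℤ; ∣_∣; _-_) renaming (_+_ to _+ℤ_)
open import Data.Fin using (Fin; zero; suc; toℕ; fromℕ<; _↑ˡ_; _↑ʳ_; cast)
open import Data.Fin.Properties using () renaming (_≟_ to _≟F_)
open import Data.List using (List; []; _∷_; _++_; map; length; removeAt; concatMap; allFin; lookup)
open import Data.List.Properties using (length-++)
open import Data.Product using (Σ; _×_; _,_; proj₁; proj₂)
open import Data.Sum using (_⊎_; inj₁; inj₂)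
import Data.Sum.Properties as SumP
import Data.Product.Properties as ProdP
open import Data.Bool using (Bool; true; false; if_then_else_)
open import Relation.Nullary using (¬_; Dec; yes; no)
open import Relation.Binary.PropositionalEquality using (_≡_; _≢_; sym)
open import Relation.Binary.Definitions using (DecidableEquality)

-- Parallel edges are allowed
-- (repeated list entries); edges are indexed by Fin (length edges).

record Graph : Set₁ where
  field
    V     : Set
    _≟V_  : DecidableEquality V
    edges : List (V × V)

  E : ℕ
  E = length edges

  ends : Fin E → V × V
  ends = lookup edges

open Graph public

_─_ : (Γ : Graph) → Fin (E Γ) → Graph
Γ ─ e = record { V = V Γ ; _≟V_ = _≟V_ Γ ; edges = removeAt (edges Γ) e }

sumℤ : (n : ℕ) → (Fin n → ℤ) → ℤ
sumℤ zero    f = 0ℤ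
sumℤ (suc n) f = f zero +ℤ sumℤ n (λ i → f (suc i))

-- k-flows.  An orientation D chooses for each edge {u,v} (stored as (u,v))
-- whether the arc goes u → v (true) or v → u (false).

Orientation : Graph → Set
Orientation Γ = Fin (E Γ) → Bool

tailD : (Γ : Graph) → Orientation Γ → Fin (E Γ) → V Γ
tailD Γ D e = if D e then proj₁ (ends Γ e) else proj₂ (ends Γ e)

headD : (Γ : Graph) → Orientation Γ → Fin (E Γ) → V Γ
headD Γ D e = if D e then proj₂ (ends Γ e) else proj₁ (ends Γ e)

indicator : ∀ {A : Set} {x y : A} → Dec (x ≡ y) → ℤ → ℤ
indicator (yes _) z = z
indicator (no _)  z = 0ℤ

outflow : (Γ : Graph) → Orientation Γ → (Fin (E Γ) → ℤ) → V Γ → ℤ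
outflow Γ D φ v =
  sumℤ (E Γ) (λ e → indicator (_≟V_ Γ (tailD Γ D e) v) (φ e)
                  - indicator (_≟V_ Γ (headD Γ D e) v) (φ e))

record IsFlow (k : ℕ) (Γ : Graph) (D : Orientation Γ) (φ : Fin (E Γ) → ℤ) : Set where
  field
    bounded      : ∀ e → ∣ φ e ∣ < k
    conservation : ∀ v → outflow Γ D φ v ≡ 0ℤ

HasNZFlow : ℕ → Graph → Set
HasNZFlow k Γ =
  Σ (Orientation Γ) λ D → Σ (Fin (E Γ) → ℤ) λ φ →
    IsFlow k Γ D φ × (∀ e → φ e ≢ 0ℤ)

record Ladder : Set₁ where
  field
    LV     : Set
    _≟L_   : DecidableEquality LV
    rungs  : List (LV × LV)
    rails  : List (LV × LV)

  graph : Graph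
  graph = record { V = LV ; _≟V_ = _≟L_ ; edges = rungs ++ rails }

  rung : Fin (length rungs) → Fin (E graph)
  rung k = cast (sym (length-++ rungs)) (k ↑ˡ length rails)

open Ladder public

pathEdges : {A : Set} → A → A → List A → List (A × A)
pathEdges a b []       = (a , b) ∷ []
pathEdges a b (x ∷ xs) = (a , x) ∷ pathEdges x b xs

next : {n : ℕ} → Fin n → Fin n
next {suc n} i = fromℕ< (m%n<n (suc (toℕ i)) (suc n))

-- Base vertices (i , s) of CL_n,
-- i : Fin n, s : Fin 2.  The rail edge {(i,s),(i+1,s)} of CL_n is replaced
-- by a path of length suc (ℓ i s) with internal vertices
-- inj₂ ((i , s) , j), j : Fin (ℓ i s).  The list R says which rungs
-- {(i,0),(i,1)} are present (R = allFin n : all n rungs).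

CLVert : (n : ℕ) → (Fin n → Fin 2 → ℕ) → Set
CLVert n ℓ = (Fin n × Fin 2) ⊎ Σ (Fin n × Fin 2) (λ p → Fin (ℓ (proj₁ p) (proj₂ p)))

CL≟ : (n : ℕ) (ℓ : Fin n → Fin 2 → ℕ) → DecidableEquality (CLVert n ℓ)
CL≟ n ℓ = SumP.≡-dec (ProdP.≡-dec _≟F_ _≟F_)
                     (ProdP.≡-dec (ProdP.≡-dec _≟F_ _≟F_) _≟F_)

CLrails : (n : ℕ) (ℓ : Fin n → Fin 2 → ℕ) → List (CLVert n ℓ × CLVert n ℓ)
CLrails n ℓ = concatMap (λ i → concatMap (λ s →
    pathEdges (inj₁ (i , s)) (inj₁ (next i , s))
              (map (λ j → inj₂ ((i , s) , j)) (allFin (ℓ i s))))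
    (allFin 2)) (allFin n)

GCL : (n : ℕ) (ℓ : Fin n → Fin 2 → ℕ) → List (Fin n) → Ladder
GCL n ℓ R = record
  { LV = CLVert n ℓ ; _≟L_ = CL≟ n ℓ
  ; rungs = map (λ i → (inj₁ (i , zero) , inj₁ (i , suc zero))) R
  ; rails = CLrails n ℓ }

-- Base vertices Fin (n + n) = ℤ_{2n};
-- rail edge {j , j+1} replaced by a path of length suc (ℓ j) with internal
-- vertices inj₂ (j , t), t : Fin (ℓ j); rungs {i , i+n} for i : Fin n.

MLVert : (n : ℕ) → (Fin (n + n) → ℕ) → Set
MLVert n ℓ = Fin (n + n) ⊎ Σ (Fin (n + n)) (λ j → Fin (ℓ j))

ML≟ : (n : ℕ) (ℓ : Fin (n + n) → ℕ) → DecidableEquality (MLVert n ℓ)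
ML≟ n ℓ = SumP.≡-dec _≟F_ (ProdP.≡-dec _≟F_ _≟F_)

GML : (n : ℕ) (ℓ : Fin (n + n) → ℕ) → Ladder
GML n ℓ = record
  { LV = MLVert n ℓ ; _≟L_ = ML≟ n ℓ
  ; rungs = map (λ i → (inj₁ (i ↑ˡ n) , inj₁ (n ↑ʳ i))) (allFin n)
  ; rails = concatMap (λ j →
      pathEdges (inj₁ j) (inj₁ (next j)) (map (λ t → inj₂ (j , t)) (allFin (ℓ j))))
      (allFin (n + n)) }

NZ3-rung-property : (L : Ladder) → Fin (length (rungs L)) → Set
NZ3-rung-property L k =
  (HasNZFlow 3 (graph L) → ¬ HasNZFlow 3 (graph L ─ rung L k))
  × (¬ HasNZFlow 3 (graph L ─ rung L k) → HasNZFlow 3 (graph L))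

module Submission where

-- The inner vertices of a subdivided rail have degree two, so a nowhere-zero
-- 3-flow carries one value along each rail path, and the question reduces to the cubic
-- ladder in which every rail path is a single edge.  At a vertex met by a rung, the three
-- values directed away from it sum to zero and lie in {±1, ±2}, so they are congruent
-- modulo 3: the class mod 3 of the rail value changes exactly at the ends of rungs and
-- stays put elsewhere.  Walking once around a rail cycle of a circular ladder, this is
-- consistent iff the number of rungs is even; on a Möbius ladder the single rail cycle is
-- always consistent, but the two ends of a rung, half way round from each other, must get
-- different classes, which happens iff the number of rungs is odd.  Conversely such a
-- colouring yields a flow with values ±1 on the rails and ±2 on the rungs.  Deleting a
-- rung changes the parity of the number of rungs.

open import Defs
open import Data.Nat using (ℕ; _≤_; _+_)
open import Data.Fin using (Fin)
open import Data.List using (List; _∷_; []; allFin; length)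
open import Data.Product using (_×_)

open import Algebra.Bundles using (CommutativeRing)
open import Data.Bool using (Bool; true; false; not; if_then_else_; _xor_)
import Data.Bool.Properties as Bool
open import Data.Empty using (⊥-elim)
open import Data.Fin using (zero; suc; toℕ; fromℕ; inject₁; lower₁; _↑ˡ_; _↑ʳ_; splitAt; cast)
open import Data.Fin.Induction using (<-weakInduction)
import Data.Fin.Properties as Fin
open import Data.Integer using (ℤ; 0ℤ; +_; -[1+_]; -_; ∣_∣; _-_) renaming (_+_ to _+ℤ_)
import Data.Integer.Properties as ℤ
open import Data.Integer.Tactic.RingSolver using (solve-∀)
open import Data.List using (map; _++_; tabulate; removeAt; concatMap; cartesianProduct)
open import Data.List.Membership.Propositional using (_∈_; _∉_)
open import Data.List.Membership.Propositional.Properties using (∈-cartesianProduct⁺; ∈-allFin)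
import Data.List.Properties as List
open import Data.List.Relation.Unary.All as All using (All; []; _∷_)
import Data.List.Relation.Unary.All.Properties as All
open import Data.List.Relation.Unary.AllPairs using ([]; _∷_)
open import Data.List.Relation.Unary.Any using (any?; here; there)
open import Data.List.Relation.Unary.Unique.Propositional using (Unique)
import Data.List.Relation.Unary.Unique.Propositional.Properties as Unique
open import Data.Nat using (zero; suc; _<_; _%_; pred; s≤s; z≤n)
open import Data.Nat.DivMod using (m<n⇒m%n≡m; n%n≡0)
import Data.Nat.Properties as ℕ
open import Data.Product using (Σ; _,_; proj₁; proj₂; map₁)
import Data.Product.Properties as ×
open import Data.Sum using (_⊎_; inj₁; inj₂; [_,_]′)
open import Function using (_∘_; _⇔_; mk⇔; Equivalence)
open import Function.Properties.Equivalence using (⇔-setoid)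
open import Level using (0ℓ)
open import Relation.Binary.Definitions using (DecidableEquality)
open import Relation.Binary.PropositionalEquality
import Relation.Binary.Reasoning.Setoid as SetoidReasoning
open import Relation.Nullary using (¬_; Dec; yes; no; does)
open import Relation.Nullary.Decidable using (dec-true; dec-false)
open import Algebra.Properties.AbelianGroup ℤ.+-0-abelianGroup using (inverseʳ-unique)

module ⇔-Reasoning = SetoidReasoning (⇔-setoid 0ℓ)

data NZ3 : ℤ → Set where
  +one : NZ3 (+ 1)
  +two : NZ3 (+ 2)
  -one : NZ3 -[1+ 0 ]
  -two : NZ3 -[1+ 1 ]

NZ3-bounded : ∀ {x} → NZ3 x → ∣ x ∣ < 3
NZ3-bounded +one = s≤s (s≤s z≤n)
NZ3-bounded +two = s≤s (s≤s (s≤s z≤n))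
NZ3-bounded -one = s≤s (s≤s z≤n)
NZ3-bounded -two = s≤s (s≤s (s≤s z≤n))

NZ3-nonzero : ∀ {x} → NZ3 x → x ≢ 0ℤ
NZ3-nonzero +one ()
NZ3-nonzero +two ()
NZ3-nonzero -one ()
NZ3-nonzero -two ()

bounded-nonzero⇒NZ3 : ∀ x → ∣ x ∣ < 3 → x ≢ 0ℤ → NZ3 x
bounded-nonzero⇒NZ3 (+ 0)           _                   x≢0 = ⊥-elim (x≢0 refl)
bounded-nonzero⇒NZ3 (+ 1)           _                   _   = +one
bounded-nonzero⇒NZ3 (+ 2)           _                   _   = +two
bounded-nonzero⇒NZ3 (+ suc (suc (suc _))) (s≤s (s≤s (s≤s ()))) _
bounded-nonzero⇒NZ3 -[1+ 0 ]        _                   _   = -one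
bounded-nonzero⇒NZ3 -[1+ 1 ]        _                   _   = -two
bounded-nonzero⇒NZ3 -[1+ suc (suc _) ] (s≤s (s≤s (s≤s ()))) _

NZ3-neg : ∀ {x} → NZ3 x → NZ3 (- x)
NZ3-neg +one = -one
NZ3-neg +two = -two
NZ3-neg -one = +one
NZ3-neg -two = +two

oneMod3 : ℤ → Bool
oneMod3 (+ 1)    = true
oneMod3 -[1+ 1 ] = true
oneMod3 _        = false

oneMod3-neg : ∀ {x} → NZ3 x → oneMod3 (- x) ≡ not (oneMod3 x)
oneMod3-neg +one = refl
oneMod3-neg +two = refl
oneMod3-neg -one = refl
oneMod3-neg -two = refl

oneMod3-pair : ∀ {x y} → NZ3 x → NZ3 y → NZ3 (- (x +ℤ y)) → oneMod3 x ≡ oneMod3 y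
oneMod3-pair +one +one _  = refl
oneMod3-pair +one +two ()
oneMod3-pair +one -one ()
oneMod3-pair +one -two _  = refl
oneMod3-pair +two +one ()
oneMod3-pair +two +two ()
oneMod3-pair +two -one _  = refl
oneMod3-pair +two -two ()
oneMod3-pair -one +one ()
oneMod3-pair -one +two _  = refl
oneMod3-pair -one -one _  = refl
oneMod3-pair -one -two ()
oneMod3-pair -two +one _  = refl
oneMod3-pair -two +two ()
oneMod3-pair -two -one ()
oneMod3-pair -two -two ()

oneMod3-zero-sum : ∀ {x y z} → NZ3 x → NZ3 y → NZ3 z → x +ℤ y +ℤ z ≡ 0ℤ →
                   oneMod3 x ≡ oneMod3 y × oneMod3 x ≡ oneMod3 z
oneMod3-zero-sum {x} {y} {z} nx ny nz sum≡0 =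
  oneMod3-pair nx ny (subst NZ3 (inverseʳ-unique (x +ℤ y) z sum≡0) nz) ,
  oneMod3-pair nx nz (subst NZ3 (inverseʳ-unique (x +ℤ z) y (trans (swap x y z) sum≡0)) ny)
  where
  swap : ∀ x y z → x +ℤ z +ℤ y ≡ x +ℤ y +ℤ z
  swap = solve-∀

-- t, a and b are the values on the rung, the outgoing rail and the incoming rail at a vertex.
oneMod3-balance : ∀ {t a b} → NZ3 t → NZ3 a → NZ3 b → t +ℤ (a - b) ≡ 0ℤ →
                  oneMod3 a ≡ oneMod3 t × oneMod3 a ≡ not (oneMod3 b)
oneMod3-balance {t} {a} {b} nt na nb balanced =
  let a∼-b , a∼t = oneMod3-zero-sum na (NZ3-neg nb) nt (trans (rearrange t a b) balanced)
  in a∼t , trans a∼-b (oneMod3-neg nb)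
  where
  rearrange : ∀ t a b → a +ℤ - b +ℤ t ≡ t +ℤ (a - b)
  rearrange = solve-∀

sign : Bool → ℤ
sign true  = + 1
sign false = -[1+ 0 ]

NZ3-sign : ∀ b → NZ3 (sign b)
NZ3-sign true  = +one
NZ3-sign false = -one

NZ3-sign-jump : ∀ b → NZ3 (sign b - sign (not b))
NZ3-sign-jump true  = +two
NZ3-sign-jump false = -two

indicator-yes : ∀ {A : Set} {x y : A} (d : Dec (x ≡ y)) z → x ≡ y → indicator d z ≡ z
indicator-yes (yes _)  z _   = refl
indicator-yes (no x≢y) z x≡y = ⊥-elim (x≢y x≡y)

indicator-no : ∀ {A : Set} {x y : A} (d : Dec (x ≡ y)) z → x ≢ y → indicator d z ≡ 0ℤ
indicator-no (yes x≡y) z x≢y = ⊥-elim (x≢y x≡y)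
indicator-no (no _)    z _   = refl

indicator-neg : ∀ {A : Set} {x y : A} (d : Dec (x ≡ y)) z → indicator d (- z) ≡ - indicator d z
indicator-neg (yes _) z = refl
indicator-neg (no _)  z = refl

indicator-cong : ∀ {A B : Set} {x y : A} {x′ y′ : B} (d : Dec (x ≡ y)) (d′ : Dec (x′ ≡ y′)) z →
                 (x ≡ y → x′ ≡ y′) → (x′ ≡ y′ → x ≡ y) → indicator d z ≡ indicator d′ z
indicator-cong (yes _)   (yes _)    z _ _ = refl
indicator-cong (yes x≡y) (no x′≢y′) z f _ = ⊥-elim (x′≢y′ (f x≡y))
indicator-cong (no x≢y)  (yes x′≡y′) z _ g = ⊥-elim (x≢y (g x′≡y′))
indicator-cong (no _)    (no _)     z _ _ = refl

sumℤ-cong : ∀ n {f g : Fin n → ℤ} → (∀ i → f i ≡ g i) → sumℤ n f ≡ sumℤ n g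
sumℤ-cong zero    f≗g = refl
sumℤ-cong (suc n) f≗g = cong₂ _+ℤ_ (f≗g zero) (sumℤ-cong n (f≗g ∘ suc))

module Arcs {V : Set} (_≟_ : DecidableEquality V) where

  Arc : Set
  Arc = (V × V) × ℤ

  arcOut : V × V → ℤ → V → ℤ
  arcOut (u , w) z v = indicator (u ≟ v) z - indicator (w ≟ v) z

  netOut : V → List Arc → ℤ
  netOut v []             = 0ℤ
  netOut v ((e , z) ∷ as) = arcOut e z v +ℤ netOut v as

  -- A nowhere-zero 3-flow in which every edge is oriented as it is stored: reversing an
  -- arc negates its value, so every nowhere-zero 3-flow can be brought into this form.
  record NZ3Flow (es : List (V × V)) : Set where
    field
      arcs       : List Arc
      arcs-edges : map proj₁ arcs ≡ es
      arcs-NZ3   : All (NZ3 ∘ proj₂) arcs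
      balanced   : ∀ v → netOut v arcs ≡ 0ℤ

  open NZ3Flow public

  netOut-++ : ∀ v as bs → netOut v (as ++ bs) ≡ netOut v as +ℤ netOut v bs
  netOut-++ v []             bs = sym (ℤ.+-identityˡ _)
  netOut-++ v ((e , z) ∷ as) bs =
    trans (cong (arcOut e z v +ℤ_) (netOut-++ v as bs)) (sym (ℤ.+-assoc (arcOut e z v) _ _))

  split-arcs : ∀ es fs (as : List Arc) → map proj₁ as ≡ es ++ fs →
               Σ (List Arc) λ as₁ → Σ (List Arc) λ as₂ →
                 as ≡ as₁ ++ as₂ × map proj₁ as₁ ≡ es × map proj₁ as₂ ≡ fs
  split-arcs []       fs as       edges = [] , as , refl , refl , edges
  split-arcs (e ∷ es) fs (a ∷ as) edges
    with refl ← List.∷-injectiveˡ edges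
    with as₁ , as₂ , refl , edges₁ , edges₂ ← split-arcs es fs as (List.∷-injectiveʳ edges)
    = a ∷ as₁ , as₂ , refl , cong (proj₁ a ∷_) edges₁ , edges₂

  edges-++ : ∀ {as bs : List Arc} {es fs : List (V × V)} → map proj₁ as ≡ es → map proj₁ bs ≡ fs →
             map proj₁ (as ++ bs) ≡ es ++ fs
  edges-++ {as} {bs} refl refl = List.map-++ proj₁ as bs

  netOut-replace : ∀ as₁ ms ms′ as₂ → (∀ v → netOut v ms ≡ netOut v ms′) →
                   ∀ v → netOut v (as₁ ++ ms ++ as₂) ≡ netOut v (as₁ ++ ms′ ++ as₂)
  netOut-replace as₁ ms ms′ as₂ same v = begin
    netOut v (as₁ ++ ms ++ as₂)                     ≡⟨ netOut-++ v as₁ _ ⟩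
    netOut v as₁ +ℤ netOut v (ms ++ as₂)            ≡⟨ cong (netOut v as₁ +ℤ_) (netOut-++ v ms as₂) ⟩
    netOut v as₁ +ℤ (netOut v ms +ℤ netOut v as₂)   ≡⟨ cong (λ m → netOut v as₁ +ℤ (m +ℤ netOut v as₂)) (same v) ⟩
    netOut v as₁ +ℤ (netOut v ms′ +ℤ netOut v as₂)  ≡⟨ cong (netOut v as₁ +ℤ_) (netOut-++ v ms′ as₂) ⟨
    netOut v as₁ +ℤ netOut v (ms′ ++ as₂)           ≡⟨ netOut-++ v as₁ _ ⟨
    netOut v (as₁ ++ ms′ ++ as₂)                    ∎
    where open ≡-Reasoning

  netOut-skip : ∀ {u w y z} as → u ≢ y → w ≢ y → netOut y (((u , w) , z) ∷ as) ≡ netOut y as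
  netOut-skip {u} {w} {y} {z} as u≢y w≢y =
    trans (cong₂ (λ p q → p - q +ℤ netOut y as) (indicator-no (u ≟ y) z u≢y) (indicator-no (w ≟ y) z w≢y))
          (ℤ.+-identityˡ _)

  netOut-tabulate : ∀ {n} (f : Fin n → Arc) v →
                    netOut v (tabulate f) ≡ sumℤ n (λ i → arcOut (proj₁ (f i)) (proj₂ (f i)) v)
  netOut-tabulate {zero}  f v = refl
  netOut-tabulate {suc n} f v =
    cong (arcOut (proj₁ (f zero)) (proj₂ (f zero)) v +ℤ_) (netOut-tabulate (f ∘ suc) v)

  ≡⇒NZ3Flow : ∀ {es fs} → es ≡ fs → NZ3Flow es ⇔ NZ3Flow fs
  ≡⇒NZ3Flow refl = mk⇔ (λ φ → φ) (λ φ → φ)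

  values : (as : List Arc) → Fin (length (map proj₁ as)) → ℤ
  values (a ∷ as) zero    = proj₂ a
  values (a ∷ as) (suc i) = values as i

  values-NZ3 : ∀ {as} → All (NZ3 ∘ proj₂) as → ∀ i → NZ3 (values as i)
  values-NZ3 (nz ∷ _)   zero    = nz
  values-NZ3 (_  ∷ nzs) (suc i) = values-NZ3 nzs i

  arcGraph : List Arc → Graph
  arcGraph as = record { V = V ; _≟V_ = _≟_ ; edges = map proj₁ as }

  outflow-arcGraph : ∀ as v → outflow (arcGraph as) (λ _ → true) (values as) v ≡ netOut v as
  outflow-arcGraph []       v = refl
  outflow-arcGraph (a ∷ as) v = cong (arcOut (proj₁ a) (proj₂ a) v +ℤ_) (outflow-arcGraph as v)

  NZ3Flow⇒hasNZFlow : ∀ {es} → NZ3Flow es →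
                      HasNZFlow 3 (record { V = V ; _≟V_ = _≟_ ; edges = es })
  NZ3Flow⇒hasNZFlow φ rewrite sym (arcs-edges φ) =
    (λ _ → true) , values (arcs φ) ,
    record { bounded      = NZ3-bounded ∘ values-NZ3 (arcs-NZ3 φ)
           ; conservation = λ v → trans (outflow-arcGraph (arcs φ) v) (balanced φ v) } ,
    NZ3-nonzero ∘ values-NZ3 (arcs-NZ3 φ)

hasNZFlow⇔NZ3Flow : (Γ : Graph) → HasNZFlow 3 Γ ⇔ Arcs.NZ3Flow (_≟V_ Γ) (edges Γ)
hasNZFlow⇔NZ3Flow Γ = mk⇔ toArcs NZ3Flow⇒hasNZFlow
  where
  open Arcs (_≟V_ Γ)

  toArcs : HasNZFlow 3 Γ → NZ3Flow (edges Γ)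
  toArcs (D , φ , φ-flow , φ≢0) = record
    { arcs       = tabulate (λ e → ends Γ e , ψ e)
    ; arcs-edges = trans (List.map-tabulate _ proj₁) (List.tabulate-lookup (edges Γ))
    ; arcs-NZ3   = All.tabulate⁺ ψ-NZ3
    ; balanced   = λ v → trans (netOut-tabulate (λ e → ends Γ e , ψ e) v)
                                (trans (sumℤ-cong (E Γ) (arcOut-ψ v)) (IsFlow.conservation φ-flow v))
    }
    where
    ψ : Fin (E Γ) → ℤ
    ψ e = if D e then φ e else - φ e

    ψ-NZ3 : ∀ e → NZ3 (ψ e)
    ψ-NZ3 e with D e
    ... | true  = bounded-nonzero⇒NZ3 (φ e) (IsFlow.bounded φ-flow e) (φ≢0 e)
    ... | false = NZ3-neg (bounded-nonzero⇒NZ3 (φ e) (IsFlow.bounded φ-flow e) (φ≢0 e))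

    arcOut-ψ : ∀ v e → arcOut (ends Γ e) (ψ e) v ≡
               indicator (_≟V_ Γ (tailD Γ D e) v) (φ e) - indicator (_≟V_ Γ (headD Γ D e) v) (φ e)
    arcOut-ψ v e with D e
    ... | true  = refl
    ... | false = trans (cong₂ _-_ (indicator-neg (_≟V_ Γ _ v) (φ e)) (indicator-neg (_≟V_ Γ _ v) (φ e)))
                        (reverse (indicator (_≟V_ Γ (proj₁ (ends Γ e)) v) (φ e))
                                 (indicator (_≟V_ Γ (proj₂ (ends Γ e)) v) (φ e)))
      where
      reverse : ∀ a b → - a - - b ≡ b - a
      reverse = solve-∀

-- Contracting subdivided rails

module Paths {V : Set} (_≟_ : DecidableEquality V) where
  open Arcs _≟_

  Avoids : V → List (V × V) → Set
  Avoids x = All (λ e → proj₁ e ≢ x × proj₂ e ≢ x)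

  netOut-avoiding : ∀ {x} as → Avoids x (map proj₁ as) → netOut x as ≡ 0ℤ
  netOut-avoiding []                 []                   = refl
  netOut-avoiding (((u , w) , z) ∷ as) ((u≢x , w≢x) ∷ avoid) =
    trans (netOut-skip as u≢x w≢x) (netOut-avoiding as avoid)

  labelled : ℤ → List (V × V) → List Arc
  labelled z = map (_, z)

  edges-labelled : ∀ z es → map proj₁ (labelled z es) ≡ es
  edges-labelled z es = trans (sym (List.map-∘ es)) (List.map-id es)

  netOut-path : ∀ z a b xs v → netOut v (labelled z (pathEdges a b xs)) ≡ arcOut (a , b) z v
  netOut-path z a b []       v = ℤ.+-identityʳ _
  netOut-path z a b (x ∷ xs) v =
    trans (cong (arcOut (a , x) z v +ℤ_) (netOut-path z x b xs v))
          (telescope (indicator (a ≟ v) z) (indicator (x ≟ v) z) (indicator (b ≟ v) z))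
    where
    telescope : ∀ p q r → p - q +ℤ (q - r) ≡ p - r
    telescope = solve-∀

  path-step-value : ∀ {a x b z z′} xs → a ≢ x → b ≢ x →
                    netOut x (((a , x) , z) ∷ labelled z′ (pathEdges x b xs)) ≡ 0ℤ → z′ ≡ z
  path-step-value {a} {x} {b} {z} {z′} xs a≢x b≢x balanced-x = begin
    z′
      ≡⟨ shift z z′ ⟩
    0ℤ - z +ℤ (z′ - 0ℤ) +ℤ z
      ≡⟨ cong₂ (λ p q → p - z +ℤ (z′ - q) +ℤ z)
               (indicator-no (a ≟ x) z a≢x) (indicator-no (b ≟ x) z′ b≢x) ⟨
    indicator (a ≟ x) z - z +ℤ (z′ - indicator (b ≟ x) z′) +ℤ z
      ≡⟨ cong₂ (λ p q → indicator (a ≟ x) z - p +ℤ (q - indicator (b ≟ x) z′) +ℤ z)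
               (indicator-yes (x ≟ x) z refl) (indicator-yes (x ≟ x) z′ refl) ⟨
    arcOut (a , x) z x +ℤ arcOut (x , b) z′ x +ℤ z
      ≡⟨ cong (λ p → arcOut (a , x) z x +ℤ p +ℤ z) (netOut-path z′ x b xs x) ⟨
    netOut x (((a , x) , z) ∷ labelled z′ (pathEdges x b xs)) +ℤ z
      ≡⟨ cong (_+ℤ z) balanced-x ⟩
    0ℤ +ℤ z
      ≡⟨ ℤ.+-identityˡ z ⟩
    z ∎
    where
    open ≡-Reasoning
    shift : ∀ z z′ → z′ ≡ 0ℤ - z +ℤ (z′ - 0ℤ) +ℤ z
    shift = solve-∀

  path-constant : ∀ {a b} xs (as : List Arc) → map proj₁ as ≡ pathEdges a b xs →
                  Unique xs → All (a ≢_) xs → All (b ≢_) xs → All (λ x → netOut x as ≡ 0ℤ) xs →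
                  Σ ℤ λ z → as ≡ labelled z (pathEdges a b xs)
  path-constant [] ((e , z) ∷ []) edges _ _ _ _ =
    z , cong (λ e → (e , z) ∷ []) (List.∷-injectiveˡ edges)
  path-constant {a} {b} (x ∷ xs) ((e , z) ∷ as) edges (x≢xs ∷ unique) (a≢x ∷ a≢xs) (b≢x ∷ b≢xs)
                (balanced-x ∷ balanced-xs)
    with refl ← List.∷-injectiveˡ edges
    with z′ , refl ← path-constant xs as (List.∷-injectiveʳ edges) unique x≢xs b≢xs
                       (All.tabulate λ y∈xs →
                          trans (sym (netOut-skip as (All.lookup a≢xs y∈xs) (All.lookup x≢xs y∈xs)))
                                (All.lookup balanced-xs y∈xs))
    = z , cong (λ w → ((a , x) , z) ∷ labelled w (pathEdges x b xs)) (path-step-value xs a≢x b≢x balanced-x)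

  netOut-middle : ∀ {x} as₁ ms as₂ → Avoids x (map proj₁ as₁) → Avoids x (map proj₁ as₂) →
                  netOut x (as₁ ++ ms ++ as₂) ≡ netOut x ms
  netOut-middle {x} as₁ ms as₂ avoid₁ avoid₂ = begin
    netOut x (as₁ ++ ms ++ as₂)            ≡⟨ netOut-++ x as₁ _ ⟩
    netOut x as₁ +ℤ netOut x (ms ++ as₂)   ≡⟨ cong₂ _+ℤ_ (netOut-avoiding as₁ avoid₁) (netOut-++ x ms as₂) ⟩
    0ℤ +ℤ (netOut x ms +ℤ netOut x as₂)    ≡⟨ ℤ.+-identityˡ _ ⟩
    netOut x ms +ℤ netOut x as₂            ≡⟨ cong (netOut x ms +ℤ_) (netOut-avoiding as₂ avoid₂) ⟩
    netOut x ms +ℤ 0ℤ                      ≡⟨ ℤ.+-identityʳ _ ⟩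
    netOut x ms                            ∎
    where open ≡-Reasoning

  path-NZ3 : ∀ {z a b} xs → All (NZ3 ∘ proj₂) (labelled z (pathEdges a b xs)) → NZ3 z
  path-NZ3 []      (nz ∷ _) = nz
  path-NZ3 (_ ∷ _) (nz ∷ _) = nz

  -- Balance at its inner vertices forces a single value along the path (path-constant),
  -- which is then put on the new path.
  reroute : ∀ {a b} es ys ys′ fs → Unique ys → All (a ≢_) ys → All (b ≢_) ys →
            All (λ y → Avoids y es × Avoids y fs) ys →
            NZ3Flow (es ++ pathEdges a b ys ++ fs) → NZ3Flow (es ++ pathEdges a b ys′ ++ fs)
  reroute {a} {b} es ys ys′ fs unique a≢ys b≢ys fresh φ
    with as₁ , rest , as≡ , refl , edges-rest ← split-arcs es _ (arcs φ) (arcs-edges φ)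
    with asP , as₂ , refl , edgesP , refl ← split-arcs (pathEdges a b ys) fs rest edges-rest
    with z , refl ← path-constant ys asP edgesP unique a≢ys b≢ys
                      (All.map (λ {y} (avoid₁ , avoid₂) →
                                  trans (sym (netOut-middle as₁ asP as₂ avoid₁ avoid₂))
                                        (trans (cong (netOut y) (sym as≡)) (balanced φ y)))
                               fresh)
    = let nz₁ , nz-rest = All.++⁻ as₁ (subst (All (NZ3 ∘ proj₂)) as≡ (arcs-NZ3 φ))
          nzP , nz₂     = All.++⁻ (labelled z (pathEdges a b ys)) nz-rest
      in record
      { arcs       = as₁ ++ labelled z (pathEdges a b ys′) ++ as₂
      ; arcs-edges = edges-++ {as₁} refl (edges-++ {labelled z (pathEdges a b ys′)} {as₂}
                                             (edges-labelled z (pathEdges a b ys′)) refl)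
      ; arcs-NZ3   = All.++⁺ nz₁ (All.++⁺ (All.map⁺ (All.universal (λ _ → path-NZ3 ys nzP) _)) nz₂)
      ; balanced   = λ v → trans (netOut-replace as₁ _ _ as₂
                                    (λ w → trans (netOut-path z a b ys′ w) (sym (netOut-path z a b ys w))) v)
                                 (trans (cong (netOut v) (sym as≡)) (balanced φ v))
      }

  contract-path : ∀ {a b} es xs fs → Unique xs → All (a ≢_) xs → All (b ≢_) xs →
                  All (λ x → Avoids x es × Avoids x fs) xs →
                  NZ3Flow (es ++ pathEdges a b xs ++ fs) ⇔ NZ3Flow (es ++ (a , b) ∷ fs)
  contract-path es xs fs unique a≢xs b≢xs fresh =
    mk⇔ (reroute es xs [] fs unique a≢xs b≢xs fresh) (reroute es [] xs fs [] [] [] [])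

liftEdge : ∀ {B C : Set} → B × B → (B ⊎ C) × (B ⊎ C)
liftEdge (a , b) = inj₁ a , inj₁ b

module Embedding {B C : Set} (_≟B_ : DecidableEquality B) (_≟_ : DecidableEquality (B ⊎ C)) where
  module Base = Arcs _≟B_
  open Arcs _≟_

  liftArc : Base.Arc → Arc
  liftArc = map₁ liftEdge

  netOut-lift : ∀ v as → netOut (inj₁ v) (map liftArc as) ≡ Base.netOut v as
  netOut-lift v []                   = refl
  netOut-lift v (((a , b) , z) ∷ as) =
    cong₂ _+ℤ_ (cong₂ _-_ (indicator-cong (inj₁ a ≟ inj₁ v) (a ≟B v) z inj₁-injective (cong inj₁))
                          (indicator-cong (inj₁ b ≟ inj₁ v) (b ≟B v) z inj₁-injective (cong inj₁)))
               (netOut-lift v as)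
    where
    inj₁-injective : ∀ {x y : B} → inj₁ {B = C} x ≡ inj₁ y → x ≡ y
    inj₁-injective refl = refl

  netOut-lift-outside : ∀ y as → netOut (inj₂ y) (map liftArc as) ≡ 0ℤ
  netOut-lift-outside y []       = refl
  netOut-lift-outside y (a ∷ as) =
    trans (netOut-skip (map liftArc as) (λ ()) (λ ())) (netOut-lift-outside y as)

  unlift : ∀ es (as : List Arc) → map proj₁ as ≡ map liftEdge es →
           Σ (List Base.Arc) λ bs → as ≡ map liftArc bs × map proj₁ bs ≡ es
  unlift []       []             _     = [] , refl , refl
  unlift (e ∷ es) ((_ , z) ∷ as) edges
    with refl ← List.∷-injectiveˡ edges
    with bs , refl , refl ← unlift es as (List.∷-injectiveʳ edges)
    = (e , z) ∷ bs , refl , refl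

  embed : ∀ es → NZ3Flow (map liftEdge es) ⇔ Base.NZ3Flow es
  embed es = mk⇔ restrict extend
    where
    restrict : NZ3Flow (map liftEdge es) → Base.NZ3Flow es
    restrict φ with bs , as≡ , edges ← unlift es (arcs φ) (arcs-edges φ) = record
      { arcs       = bs
      ; arcs-edges = edges
      ; arcs-NZ3   = All.map⁻ (subst (All (NZ3 ∘ proj₂)) as≡ (arcs-NZ3 φ))
      ; balanced   = λ v → trans (sym (netOut-lift v bs))
                                 (trans (cong (netOut (inj₁ v)) (sym as≡)) (balanced φ (inj₁ v)))
      }

    extend : Base.NZ3Flow es → NZ3Flow (map liftEdge es)
    extend ψ = record
      { arcs       = map liftArc (Base.arcs ψ)
      ; arcs-edges = trans (sym (List.map-∘ (Base.arcs ψ)))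
                           (trans (List.map-∘ (Base.arcs ψ)) (cong (map liftEdge) (Base.arcs-edges ψ)))
      ; arcs-NZ3   = All.map⁺ (Base.arcs-NZ3 ψ)
      ; balanced   = λ { (inj₁ v) → trans (netOut-lift v (Base.arcs ψ)) (Base.balanced ψ v)
                       ; (inj₂ y) → netOut-lift-outside y (Base.arcs ψ) }
      }

module Subdivision {B : Set} (ℓ : B → ℕ) (next : B → B)
                   (_≟B_ : DecidableEquality B) (_≟_ : DecidableEquality (B ⊎ Σ B (Fin ∘ ℓ))) where
  open Arcs _≟_
  open Paths _≟_
  open Embedding _≟B_ _≟_

  inner : B → List (B ⊎ Σ B (Fin ∘ ℓ))
  inner b = map (λ j → inj₂ (b , j)) (allFin (ℓ b))

  railPath : B → List ((B ⊎ Σ B (Fin ∘ ℓ)) × (B ⊎ Σ B (Fin ∘ ℓ)))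
  railPath b = pathEdges (inj₁ b) (inj₁ (next b)) (inner b)

  rail : B → B × B
  rail b = b , next b

  pathEdges-avoids : ∀ {x a b} ys → a ≢ x → b ≢ x → All (_≢ x) ys → Avoids x (pathEdges a b ys)
  pathEdges-avoids []       a≢x b≢x []          = (a≢x , b≢x) ∷ []
  pathEdges-avoids (y ∷ ys) a≢x b≢x (y≢x ∷ ys≢x) = (a≢x , y≢x) ∷ pathEdges-avoids ys y≢x b≢x ys≢x

  inner-unique : ∀ b → Unique (inner b)
  inner-unique b = Unique.map⁺ (λ { refl → refl }) (Unique.allFin⁺ (ℓ b))

  outside-inner : ∀ {b} (v : B) → All (inj₁ v ≢_) (inner b)
  outside-inner v = All.map⁺ (All.universal (λ _ ()) _)

  lifted-avoid : ∀ {y} es → Avoids (inj₂ y) (map liftEdge es)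
  lifted-avoid es = All.map⁺ (All.universal (λ _ → (λ ()) , (λ ())) es)

  rails-avoid : ∀ {b j} bs → All (b ≢_) bs → Avoids (inj₂ (b , j)) (concatMap railPath bs)
  rails-avoid bs b≢bs = All.concat⁺ (All.map⁺ (All.map railPath-avoid b≢bs))
    where
    railPath-avoid : ∀ {b j b′} → b ≢ b′ → Avoids (inj₂ (b , j)) (railPath b′)
    railPath-avoid b≢b′ = pathEdges-avoids _ (λ ()) (λ ())
                            (All.map⁺ (All.universal (λ { _ refl → b≢b′ refl }) _))

  subdivide : ∀ rs bs → Unique bs →
              NZ3Flow (map liftEdge rs ++ concatMap railPath bs) ⇔ Base.NZ3Flow (rs ++ map rail bs)
  subdivide rs [] [] = begin
    NZ3Flow (map liftEdge rs ++ [])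
      ≈⟨ ≡⇒NZ3Flow (trans (List.++-identityʳ _) (cong (map liftEdge) (sym (List.++-identityʳ rs)))) ⟩
    NZ3Flow (map liftEdge (rs ++ []))
      ≈⟨ embed (rs ++ []) ⟩
    Base.NZ3Flow (rs ++ [])
      ∎
    where open ⇔-Reasoning
  subdivide rs (b ∷ bs) (b≢bs ∷ unique) = begin
    NZ3Flow (map liftEdge rs ++ railPath b ++ concatMap railPath bs)
      ≈⟨ contract-path (map liftEdge rs) (inner b) (concatMap railPath bs) (inner-unique b)
                       (outside-inner b) (outside-inner (next b))
                       (All.map⁺ (All.universal (λ _ → lifted-avoid rs , rails-avoid bs b≢bs) _)) ⟩
    NZ3Flow (map liftEdge rs ++ liftEdge (rail b) ∷ concatMap railPath bs)
      ≈⟨ ≡⇒NZ3Flow (trans (sym (List.++-assoc (map liftEdge rs) _ _))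
                          (cong (_++ concatMap railPath bs) (sym (List.map-++ liftEdge rs _)))) ⟩
    NZ3Flow (map liftEdge (rs ++ rail b ∷ []) ++ concatMap railPath bs)
      ≈⟨ subdivide (rs ++ rail b ∷ []) bs unique ⟩
    Base.NZ3Flow ((rs ++ rail b ∷ []) ++ map rail bs)
      ≈⟨ Base.≡⇒NZ3Flow (List.++-assoc rs _ _) ⟩
    Base.NZ3Flow (rs ++ map rail (b ∷ bs))
      ∎
    where open ⇔-Reasoning

-- Colourings of a cycle

prev : ∀ {n} → Fin n → Fin n
prev {suc n} zero    = fromℕ n
prev {suc n} (suc i) = inject₁ i

next-inject₁ : ∀ {n} (i : Fin n) → next (inject₁ i) ≡ suc i
next-inject₁ {n} i = Fin.toℕ-injective (begin
  toℕ (next (inject₁ i))       ≡⟨ Fin.toℕ-fromℕ< _ ⟩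
  suc (toℕ (inject₁ i)) % suc n ≡⟨ cong (λ k → suc k % suc n) (Fin.toℕ-inject₁ i) ⟩
  suc (toℕ i) % suc n        ≡⟨ m<n⇒m%n≡m (s≤s (Fin.toℕ<n i)) ⟩
  suc (toℕ i)                  ∎)
  where open ≡-Reasoning

next-fromℕ : ∀ n → next (fromℕ n) ≡ zero
next-fromℕ n = Fin.toℕ-injective (begin
  toℕ (next (fromℕ n))         ≡⟨ Fin.toℕ-fromℕ< _ ⟩
  suc (toℕ (fromℕ n)) % suc n ≡⟨ cong (λ k → suc k % suc n) (Fin.toℕ-fromℕ n) ⟩
  suc n % suc n              ≡⟨ n%n≡0 (suc n) ⟩
  0                            ∎)
  where open ≡-Reasoning

next-prev : ∀ {n} (i : Fin n) → next (prev i) ≡ i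
next-prev {suc n} zero    = next-fromℕ n
next-prev {suc n} (suc i) = next-inject₁ i

fromℕ-or-inject₁ : ∀ {n} (i : Fin (suc n)) → i ≡ fromℕ n ⊎ Σ (Fin n) λ j → i ≡ inject₁ j
fromℕ-or-inject₁ {n} i with n ℕ.≟ toℕ i
... | yes n≡i = inj₁ (Fin.toℕ-injective (sym (trans (Fin.toℕ-fromℕ n) n≡i)))
... | no n≢i  = inj₂ (lower₁ i n≢i , sym (Fin.inject₁-lower₁ i n≢i))

prev-next : ∀ {n} (i : Fin n) → prev (next i) ≡ i
prev-next {suc n} i with fromℕ-or-inject₁ i
... | inj₁ refl       = cong prev (next-fromℕ n)
... | inj₂ (j , refl) = cong prev (next-inject₁ j)

xorSum : ∀ {n} → (Fin n → Bool) → Bool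
xorSum {zero}  f = false
xorSum {suc n} f = f zero xor xorSum (f ∘ suc)

prefixXor : ∀ {n} → (Fin n → Bool) → Fin n → Bool
prefixXor f zero    = f zero
prefixXor f (suc i) = f zero xor prefixXor (f ∘ suc) i

prefixXor-suc : ∀ {n} (f : Fin (suc n) → Bool) (i : Fin n) →
                prefixXor f (suc i) ≡ prefixXor f (inject₁ i) xor f (suc i)
prefixXor-suc f zero    = refl
prefixXor-suc f (suc i) =
  trans (cong (f zero xor_) (prefixXor-suc (f ∘ suc) i))
        (sym (Bool.xor-assoc (f zero) (prefixXor (f ∘ suc) (inject₁ i)) (f (suc (suc i)))))

prefixXor-fromℕ : ∀ n (f : Fin (suc n) → Bool) → prefixXor f (fromℕ n) ≡ xorSum f
prefixXor-fromℕ zero    f = sym (Bool.xor-identityʳ (f zero))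
prefixXor-fromℕ (suc n) f = cong (f zero xor_) (prefixXor-fromℕ n (f ∘ suc))

prefixXor-cong : ∀ {n} {f g : Fin n → Bool} → (∀ i → f i ≡ g i) →
                 ∀ i → prefixXor f i ≡ prefixXor g i
prefixXor-cong f≗g zero    = f≗g zero
prefixXor-cong f≗g (suc i) = cong₂ _xor_ (f≗g zero) (prefixXor-cong (f≗g ∘ suc) i)

xorSum-↑ : ∀ m {n} (f : Fin (m + n) → Bool) →
           xorSum f ≡ xorSum (f ∘ (_↑ˡ n)) xor xorSum (f ∘ (m ↑ʳ_))
xorSum-↑ zero    f = refl
xorSum-↑ (suc m) f =
  trans (cong (f zero xor_) (xorSum-↑ m (f ∘ suc))) (sym (Bool.xor-assoc (f zero) _ _))

prefixXor-↑ˡ : ∀ {m} n (f : Fin (m + n) → Bool) (i : Fin m) →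
               prefixXor f (i ↑ˡ n) ≡ prefixXor (f ∘ (_↑ˡ n)) i
prefixXor-↑ˡ n f zero    = refl
prefixXor-↑ˡ n f (suc i) = cong (f zero xor_) (prefixXor-↑ˡ n (f ∘ suc) i)

prefixXor-↑ʳ : ∀ m {n} (f : Fin (m + n) → Bool) (i : Fin n) →
               prefixXor f (m ↑ʳ i) ≡ xorSum (f ∘ (_↑ˡ n)) xor prefixXor (f ∘ (m ↑ʳ_)) i
prefixXor-↑ʳ zero    f i = refl
prefixXor-↑ʳ (suc m) f i =
  trans (cong (f zero xor_) (prefixXor-↑ʳ m (f ∘ suc) i)) (sym (Bool.xor-assoc (f zero) _ _))

xorSum-cong : ∀ {n} {f g : Fin n → Bool} → (∀ i → f i ≡ g i) → xorSum f ≡ xorSum g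
xorSum-cong {zero}  f≗g = refl
xorSum-cong {suc n} f≗g = cong₂ _xor_ (f≗g zero) (xorSum-cong (f≗g ∘ suc))

-- σ changes colour exactly at the vertices marked by f as one walks around the cycle ℤ_n.
Switching : ∀ {n} → (Fin n → Bool) → (Fin n → Bool) → Set
Switching f σ = ∀ i → σ i ≡ f i xor σ (prev i)

prefixXor-switching : ∀ {n} (f : Fin (suc n) → Bool) → xorSum f ≡ false → Switching f (prefixXor f)
prefixXor-switching {n} f even zero    =
  sym (trans (cong (f zero xor_) (trans (prefixXor-fromℕ n f) even)) (Bool.xor-identityʳ (f zero)))
prefixXor-switching     f even (suc i) = trans (prefixXor-suc f i) (Bool.xor-comm _ (f (suc i)))

switching-invariant : ∀ {n} {f σ : Fin (suc n) → Bool} → Switching f σ →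
                      ∀ i → σ i xor prefixXor f i ≡ σ zero xor f zero
switching-invariant {f = f} {σ} switching = <-weakInduction _ refl step
  where
  step : ∀ i → σ (inject₁ i) xor prefixXor f (inject₁ i) ≡ σ zero xor f zero →
         σ (suc i) xor prefixXor f (suc i) ≡ σ zero xor f zero
  step i invariant = begin
    σ (suc i) xor prefixXor f (suc i)
      ≡⟨ cong₂ _xor_ (switching (suc i)) (prefixXor-suc f i) ⟩
    (f (suc i) xor σ (inject₁ i)) xor (prefixXor f (inject₁ i) xor f (suc i))
      ≡⟨ cancel (σ (inject₁ i)) _ (f (suc i)) ⟩
    σ (inject₁ i) xor prefixXor f (inject₁ i)
      ≡⟨ invariant ⟩
    σ zero xor f zero ∎
    where
    open ≡-Reasoning
    cancel : ∀ a b c → (c xor a) xor (b xor c) ≡ a xor b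
    cancel false false false = refl
    cancel false false true  = refl
    cancel false true  false = refl
    cancel false true  true  = refl
    cancel true  false false = refl
    cancel true  false true  = refl
    cancel true  true  false = refl
    cancel true  true  true  = refl

switching⇒even : ∀ {n} {f σ : Fin (suc n) → Bool} → Switching f σ → xorSum f ≡ false
switching⇒even {n} {f} {σ} switching = cancel (σ (fromℕ n)) (f zero) (xorSum f) (begin
  σ (fromℕ n) xor xorSum f                  ≡⟨ cong (σ (fromℕ n) xor_) (prefixXor-fromℕ n f) ⟨
  σ (fromℕ n) xor prefixXor f (fromℕ n)     ≡⟨ switching-invariant switching (fromℕ n) ⟩
  σ zero xor f zero                         ≡⟨ cong (_xor f zero) (switching zero) ⟩
  (f zero xor σ (fromℕ n)) xor f zero       ∎)
  where
  open ≡-Reasoning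
  cancel : ∀ a c x → a xor x ≡ (c xor a) xor c → x ≡ false
  cancel false false x    eq = eq
  cancel false true  x    eq = eq
  cancel true  false false eq = refl
  cancel true  true  false eq = refl

switching⇔even : ∀ {n} (f : Fin (suc n) → Bool) →
                 Σ (Fin (suc n) → Bool) (Switching f) ⇔ (xorSum f ≡ false)
switching⇔even f = mk⇔ (λ (_ , switching) → switching⇒even {f = f} switching)
                       (λ even → prefixXor f , prefixXor-switching f even)

infix 4 _∈?_
_∈?_ : ∀ {n} (i : Fin n) (R : List (Fin n)) → Dec (i ∈ R)
i ∈? R = any? (i Fin.≟_) R

odd : ℕ → Bool
odd zero    = false
odd (suc n) = not (odd n)

xorSum-xor : ∀ {n} (f g : Fin n → Bool) → xorSum (λ i → f i xor g i) ≡ xorSum f xor xorSum g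
xorSum-xor {zero}  f g = refl
xorSum-xor {suc n} f g =
  trans (cong ((f zero xor g zero) xor_) (xorSum-xor (f ∘ suc) (g ∘ suc)))
        (interchange (f zero) (g zero) (xorSum (f ∘ suc)) (xorSum (g ∘ suc)))
  where
  open import Algebra.Properties.CommutativeSemigroup
    (CommutativeRing.+-commutativeSemigroup Bool.xor-∧-commutativeRing) using (interchange)

xorSum-false : ∀ n → xorSum {n} (λ _ → false) ≡ false
xorSum-false zero    = refl
xorSum-false (suc n) = xorSum-false n

xorSum-single : ∀ {n} (k : Fin n) → xorSum (λ i → does (i Fin.≟ k)) ≡ true
xorSum-single {suc n} zero    = cong not (xorSum-false n)
xorSum-single {suc n} (suc k) = xorSum-single k

xorSum-∈ : ∀ {n} (R : List (Fin n)) → Unique R → xorSum (λ i → does (i ∈? R)) ≡ odd (length R)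
xorSum-∈ {n} []      []             = xorSum-false n
xorSum-∈ {n} (k ∷ R) (k∉R ∷ unique) = begin
  xorSum (λ i → does (i ∈? k ∷ R))
    ≡⟨ xorSum-cong ∈-cons ⟩
  xorSum (λ i → does (i Fin.≟ k) xor does (i ∈? R))
    ≡⟨ xorSum-xor (λ i → does (i Fin.≟ k)) (λ i → does (i ∈? R)) ⟩
  xorSum (λ i → does (i Fin.≟ k)) xor xorSum (λ i → does (i ∈? R))
    ≡⟨ cong₂ _xor_ (xorSum-single k) (xorSum-∈ R unique) ⟩
  not (odd (length R)) ∎
  where
  open ≡-Reasoning
  ∈-cons : ∀ (i : Fin n) → does (i ∈? k ∷ R) ≡ does (i Fin.≟ k) xor does (i ∈? R)
  ∈-cons i with i Fin.≟ k
  ... | yes refl = cong not (sym (dec-false (i ∈? R) (All.All¬⇒¬Any k∉R)))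
  ... | no _     = refl

sumOver : ∀ {X : Set} → List X → (X → ℤ) → ℤ
sumOver []       g = 0ℤ
sumOver (x ∷ xs) g = g x +ℤ sumOver xs g

module _ {X : Set} (_≟X_ : DecidableEquality X) where

  sumOver-cong : ∀ xs {g h : X → ℤ} → (∀ x → g x ≡ h x) → sumOver xs g ≡ sumOver xs h
  sumOver-cong []       g≗h = refl
  sumOver-cong (x ∷ xs) g≗h = cong₂ _+ℤ_ (g≗h x) (sumOver-cong xs g≗h)

  sumOver-minus : ∀ xs (g h : X → ℤ) → sumOver xs (λ x → g x - h x) ≡ sumOver xs g - sumOver xs h
  sumOver-minus []       g h = refl
  sumOver-minus (x ∷ xs) g h = trans (cong (g x - h x +ℤ_) (sumOver-minus xs g h))
                                     (regroup (g x) (h x) (sumOver xs g) (sumOver xs h))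
    where
    regroup : ∀ a b c d → a - b +ℤ (c - d) ≡ a +ℤ c - (b +ℤ d)
    regroup = solve-∀

  sumOver-neg : ∀ xs (g : X → ℤ) → sumOver xs (λ x → - g x) ≡ - sumOver xs g
  sumOver-neg []       g = refl
  sumOver-neg (x ∷ xs) g =
    trans (cong (- g x +ℤ_) (sumOver-neg xs g)) (sym (ℤ.neg-distrib-+ (g x) (sumOver xs g)))

  sumOver-miss : ∀ {y} xs (g : X → ℤ) → y ∉ xs → sumOver xs (λ x → indicator (x ≟X y) (g x)) ≡ 0ℤ
  sumOver-miss []       g y∉xs = refl
  sumOver-miss (x ∷ xs) g y∉xs =
    cong₂ _+ℤ_ (indicator-no (x ≟X _) (g x) (λ { refl → y∉xs (here refl) }))
               (sumOver-miss xs g (y∉xs ∘ there))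

  sumOver-pick : ∀ {y} xs (g : X → ℤ) → Unique xs → y ∈ xs →
                 sumOver xs (λ x → indicator (x ≟X y) (g x)) ≡ g y
  sumOver-pick (x ∷ xs) g (x∉xs ∷ _) (here refl) =
    trans (cong₂ _+ℤ_ (indicator-yes (x ≟X x) (g x) refl) (sumOver-miss xs g (All.All¬⇒¬Any x∉xs)))
          (ℤ.+-identityʳ (g x))
  sumOver-pick (x ∷ xs) g (x∉xs ∷ unique) (there y∈xs) =
    trans (cong₂ _+ℤ_ (indicator-no (x ≟X _) (g x) (λ { refl → All.lookup x∉xs y∈xs refl }))
                      (sumOver-pick xs g unique y∈xs))
          (ℤ.+-identityˡ _)

module Labellings {V : Set} (_≟_ : DecidableEquality V) where
  open Arcs _≟_

  labelling : ∀ {X : Set} → (X → V × V) → (X → ℤ) → List X → List Arc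
  labelling e f = map (λ x → e x , f x)

  edges-labelling : ∀ {X : Set} (e : X → V × V) f xs → map proj₁ (labelling e f xs) ≡ map e xs
  edges-labelling e f xs = sym (List.map-∘ xs)

  netOut-labelling : ∀ {X : Set} (e : X → V × V) f xs v →
                     netOut v (labelling e f xs) ≡ sumOver xs (λ x → arcOut (e x) (f x) v)
  netOut-labelling e f []       v = refl
  netOut-labelling e f (x ∷ xs) v = cong (arcOut (e x) (f x) v +ℤ_) (netOut-labelling e f xs v)

  labelling-function : ∀ {X : Set} → DecidableEquality X → (e : X → V × V) → ∀ xs → Unique xs →
                       (as : List Arc) → map proj₁ as ≡ map e xs →
                       Σ (X → ℤ) λ f → as ≡ labelling e f xs
  labelling-function         _≟X_ e []       []              []             refl  = (λ _ → 0ℤ) , refl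
  labelling-function {X = X} _≟X_ e (x ∷ xs) (x∉xs ∷ unique) ((_ , z) ∷ as) edges
    with refl ← List.∷-injectiveˡ edges
    with f , refl ← labelling-function _≟X_ e xs unique as (List.∷-injectiveʳ edges)
    = f′ , cong₂ _∷_ (cong (e x ,_) (sym (f′-here)))
                     (List.map-cong-local
                        (All.map (λ x≢y → cong (e _ ,_) (sym (f′-elsewhere x≢y))) x∉xs))
    where
    f′ : X → ℤ
    f′ y with y ≟X x
    ... | yes _ = z
    ... | no  _ = f y
    f′-here : f′ x ≡ z
    f′-here with x ≟X x
    ... | yes _   = refl
    ... | no x≢x  = ⊥-elim (x≢x refl)
    f′-elsewhere : ∀ {y} → x ≢ y → f′ y ≡ f y
    f′-elsewhere {y} x≢y with y ≟X x
    ... | yes refl = ⊥-elim (x≢y refl)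
    ... | no  _    = refl

-- A ladder-shaped base graph: every vertex is the tail or the head of exactly one
-- potential rung, and the rails form the cycles of the permutation next.
module LadderFlows {V : Set} {m : ℕ} (_≟_ : DecidableEquality V)
  (tail head : Fin m → V) (tail-injective : ∀ {i j} → tail i ≡ tail j → i ≡ j)
  (head-injective : ∀ {i j} → head i ≡ head j → i ≡ j) (tail≢head : ∀ i j → tail i ≢ head j)
  (tail-or-head : ∀ v → Σ (Fin m) (λ i → v ≡ tail i) ⊎ Σ (Fin m) (λ i → v ≡ head i))
  (next prev : V → V) (prev-next : ∀ v → prev (next v) ≡ v) (next-prev : ∀ v → next (prev v) ≡ v)
  (cells : List V) (cells-unique : Unique cells) (cells-complete : ∀ v → v ∈ cells)
  where
  open Arcs _≟_
  open Labellings _≟_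

  rungEdge : Fin m → V × V
  rungEdge i = tail i , head i

  railEdge : V → V × V
  railEdge v = v , next v

  -- The value t i of rung i when the rung is present, and 0 otherwise.
  rungValue : List (Fin m) → (Fin m → ℤ) → Fin m → ℤ
  rungValue R t i = sumOver R (λ k → indicator (k Fin.≟ i) (t k))

  rungValue-∈ : ∀ {R i} t → Unique R → i ∈ R → rungValue R t i ≡ t i
  rungValue-∈ {R} t = sumOver-pick Fin._≟_ R t

  rungValue-∉ : ∀ {R i} t → i ∉ R → rungValue R t i ≡ 0ℤ
  rungValue-∉ {R} t = sumOver-miss Fin._≟_ R t

  netOut-tail : ∀ R t i → netOut (tail i) (labelling rungEdge t R) ≡ rungValue R t i
  netOut-tail R t i = trans (netOut-labelling rungEdge t R (tail i)) (sumOver-cong Fin._≟_ R at-tail)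
    where
    at-tail : ∀ k → arcOut (rungEdge k) (t k) (tail i) ≡ indicator (k Fin.≟ i) (t k)
    at-tail k =
      trans (cong₂ _-_ (indicator-cong (tail k ≟ tail i) (k Fin.≟ i) (t k) tail-injective (cong tail))
                       (indicator-no (head k ≟ tail i) (t k) (λ eq → tail≢head i k (sym eq))))
            (ℤ.+-identityʳ _)

  netOut-head : ∀ R t i → netOut (head i) (labelling rungEdge t R) ≡ - rungValue R t i
  netOut-head R t i = trans (netOut-labelling rungEdge t R (head i))
                            (trans (sumOver-cong Fin._≟_ R at-head) (sumOver-neg Fin._≟_ R _))
    where
    at-head : ∀ k → arcOut (rungEdge k) (t k) (head i) ≡ - indicator (k Fin.≟ i) (t k)
    at-head k =
      trans (cong₂ _-_ (indicator-no (tail k ≟ head i) (t k) (tail≢head k i))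
                       (indicator-cong (head k ≟ head i) (k Fin.≟ i) (t k) head-injective (cong head)))
            (ℤ.+-identityˡ _)

  netOut-rails : ∀ c v → netOut v (labelling railEdge c cells) ≡ c v - c (prev v)
  netOut-rails c v = begin
    netOut v (labelling railEdge c cells)
      ≡⟨ netOut-labelling railEdge c cells v ⟩
    sumOver cells (λ u → arcOut (railEdge u) (c u) v)
      ≡⟨ sumOver-cong _≟_ cells at-v ⟩
    sumOver cells (λ u → indicator (u ≟ v) (c u) - indicator (u ≟ prev v) (c u))
      ≡⟨ sumOver-minus _≟_ cells _ _ ⟩
    sumOver cells (λ u → indicator (u ≟ v) (c u)) - sumOver cells (λ u → indicator (u ≟ prev v) (c u))
      ≡⟨ cong₂ _-_ (sumOver-pick _≟_ cells c cells-unique (cells-complete v))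
                   (sumOver-pick _≟_ cells c cells-unique (cells-complete (prev v))) ⟩
    c v - c (prev v) ∎
    where
    open ≡-Reasoning
    at-v : ∀ u → arcOut (railEdge u) (c u) v ≡ indicator (u ≟ v) (c u) - indicator (u ≟ prev v) (c u)
    at-v u = cong (λ x → indicator (u ≟ v) (c u) - x)
                  (indicator-cong (next u ≟ v) (u ≟ prev v) (c u)
                                  (λ { refl → sym (prev-next u) }) (λ { refl → next-prev v }))

  record LadderFlow (R : List (Fin m)) : Set where
    field
      rungFlow      : Fin m → ℤ
      railFlow      : V → ℤ
      rungFlow-NZ3  : All (NZ3 ∘ rungFlow) R
      railFlow-NZ3  : ∀ v → NZ3 (railFlow v)
      tail-balanced : ∀ i →   rungValue R rungFlow i +ℤ (railFlow (tail i) - railFlow (prev (tail i))) ≡ 0ℤ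
      head-balanced : ∀ i → - rungValue R rungFlow i +ℤ (railFlow (head i) - railFlow (prev (head i))) ≡ 0ℤ

  NZ3Flow⇔LadderFlow : ∀ R → Unique R → NZ3Flow (map rungEdge R ++ map railEdge cells) ⇔ LadderFlow R
  NZ3Flow⇔LadderFlow R R-unique = mk⇔ toLadder fromLadder
    where
    toLadder : NZ3Flow (map rungEdge R ++ map railEdge cells) → LadderFlow R
    toLadder φ
      with as₁ , as₂ , as≡ , edges₁ , edges₂ ← split-arcs (map rungEdge R) _ (arcs φ) (arcs-edges φ)
      with t , refl ← labelling-function Fin._≟_ rungEdge R R-unique as₁ edges₁
      with c , refl ← labelling-function _≟_ railEdge cells cells-unique as₂ edges₂
      = let nz-t , nz-c = All.++⁻ (labelling rungEdge t R) (subst (All (NZ3 ∘ proj₂)) as≡ (arcs-NZ3 φ))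
            balanced-at v = trans (sym (netOut-++ v (labelling rungEdge t R) _))
                                  (trans (cong (netOut v) (sym as≡)) (balanced φ v))
        in record
        { rungFlow      = t
        ; railFlow      = c
        ; rungFlow-NZ3  = All.map⁻ nz-t
        ; railFlow-NZ3  = λ v → All.lookup (All.map⁻ nz-c) (cells-complete v)
        ; tail-balanced = λ i → trans (sym (cong₂ _+ℤ_ (netOut-tail R t i) (netOut-rails c (tail i))))
                                      (balanced-at (tail i))
        ; head-balanced = λ i → trans (sym (cong₂ _+ℤ_ (netOut-head R t i) (netOut-rails c (head i))))
                                      (balanced-at (head i))
        }

    fromLadder : LadderFlow R → NZ3Flow (map rungEdge R ++ map railEdge cells)
    fromLadder ψ = record
      { arcs       = labelling rungEdge rungFlow R ++ labelling railEdge railFlow cells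
      ; arcs-edges = edges-++ (edges-labelling rungEdge rungFlow R)
                              (edges-labelling railEdge railFlow cells)
      ; arcs-NZ3   = All.++⁺ (All.map⁺ rungFlow-NZ3) (All.map⁺ (All.universal railFlow-NZ3 cells))
      ; balanced   = balanced′
      }
      where
      open LadderFlow ψ
      balanced′ : ∀ v → netOut v (labelling rungEdge rungFlow R ++ labelling railEdge railFlow cells) ≡ 0ℤ
      balanced′ v with tail-or-head v
      ... | inj₁ (i , refl) =
        trans (netOut-++ (tail i) (labelling rungEdge rungFlow R) _)
              (trans (cong₂ _+ℤ_ (netOut-tail R rungFlow i) (netOut-rails railFlow (tail i))) (tail-balanced i))
      ... | inj₂ (i , refl) =
        trans (netOut-++ (head i) (labelling rungEdge rungFlow R) _)
              (trans (cong₂ _+ℤ_ (netOut-head R rungFlow i) (netOut-rails railFlow (head i))) (head-balanced i))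

  record Colouring (R : List (Fin m)) (σ : V → Bool) : Set where
    field
      tail-switch : ∀ i → σ (tail i) ≡ does (i ∈? R) xor σ (prev (tail i))
      head-switch : ∀ i → σ (head i) ≡ does (i ∈? R) xor σ (prev (head i))
      ends-differ : ∀ {i} → i ∈ R → σ (head i) ≡ not (σ (tail i))

  module _ {R : List (Fin m)} (R-unique : Unique R) where

    LadderFlow⇒Colouring : (ψ : LadderFlow R) → Colouring R (oneMod3 ∘ LadderFlow.railFlow ψ)
    LadderFlow⇒Colouring ψ = record
      { tail-switch = λ i → switch (rungValue R rungFlow i) (rungFlow i) (tail i)
                              (rungValue-∈ rungFlow R-unique) (rungValue-∉ rungFlow) (All.lookup rungFlow-NZ3)
                              (tail-balanced i)
      ; head-switch = λ i → switch (- rungValue R rungFlow i) (- rungFlow i) (head i)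
                              (λ i∈R → cong -_ (rungValue-∈ rungFlow R-unique i∈R))
                              (λ i∉R → cong -_ (rungValue-∉ rungFlow i∉R))
                              (NZ3-neg ∘ All.lookup rungFlow-NZ3)
                              (head-balanced i)
      ; ends-differ = λ i∈R → trans (head-class i∈R) (trans (oneMod3-neg (All.lookup rungFlow-NZ3 i∈R))
                                                             (cong not (sym (tail-class i∈R))))
      }
      where
      open LadderFlow ψ
      colour : V → Bool
      colour = oneMod3 ∘ railFlow

      switch : ∀ {i} r t v → (i ∈ R → r ≡ t) → (i ∉ R → r ≡ 0ℤ) → (i ∈ R → NZ3 t) →
               r +ℤ (railFlow v - railFlow (prev v)) ≡ 0ℤ → colour v ≡ does (i ∈? R) xor colour (prev v)
      switch {i} r t v present absent nz balanced with i ∈? R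
      ... | yes i∈R = proj₂ (oneMod3-balance (nz i∈R) (railFlow-NZ3 v) (railFlow-NZ3 (prev v))
                                             (trans (cong (_+ℤ _) (sym (present i∈R))) balanced))
      ... | no  i∉R = cong oneMod3 (ℤ.i-j≡0⇒i≡j _ _ (trans (sym (ℤ.+-identityˡ _))
                                                          (trans (cong (_+ℤ _) (sym (absent i∉R))) balanced)))

      tail-class : ∀ {i} → i ∈ R → colour (tail i) ≡ oneMod3 (rungFlow i)
      tail-class {i} i∈R =
        proj₁ (oneMod3-balance (All.lookup rungFlow-NZ3 i∈R) (railFlow-NZ3 _) (railFlow-NZ3 _)
                 (trans (cong (_+ℤ _) (sym (rungValue-∈ rungFlow R-unique i∈R))) (tail-balanced i)))

      head-class : ∀ {i} → i ∈ R → colour (head i) ≡ oneMod3 (- rungFlow i)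
      head-class {i} i∈R =
        proj₁ (oneMod3-balance (NZ3-neg (All.lookup rungFlow-NZ3 i∈R)) (railFlow-NZ3 _) (railFlow-NZ3 _)
                 (trans (cong (_+ℤ _) (sym (cong -_ (rungValue-∈ rungFlow R-unique i∈R)))) (head-balanced i)))

    Colouring⇒LadderFlow : ∀ {σ} → Colouring R σ → LadderFlow R
    Colouring⇒LadderFlow {σ} χ = record
      { rungFlow      = jump ∘ tail
      ; railFlow      = sign ∘ σ
      ; rungFlow-NZ3  = All.tabulate λ {i} i∈R →
                          subst (λ b → NZ3 (sign (σ (prev (tail i))) - sign b))
                                (sym (present-switch tail-switch i∈R)) (NZ3-sign-jump (σ (prev (tail i))))
      ; railFlow-NZ3  = NZ3-sign ∘ σ
      ; tail-balanced = λ i → balanced-at (tail i) (rungValue-∈ (jump ∘ tail) R-unique)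
                                          (rungValue-∉ (jump ∘ tail)) (tail-switch i)
      ; head-balanced = λ i → balanced-at (head i)
                                (λ i∈R → trans (cong -_ (rungValue-∈ (jump ∘ tail) R-unique i∈R))
                                               (opposite-jumps i∈R))
                                (λ i∉R → cong -_ (rungValue-∉ (jump ∘ tail) i∉R)) (head-switch i)
      }
      where
      open Colouring χ

      jump : V → ℤ
      jump v = sign (σ (prev v)) - sign (σ v)

      present-switch : ∀ {end : Fin m → V} →
                       (∀ i → σ (end i) ≡ does (i ∈? R) xor σ (prev (end i))) →
                       ∀ {i} → i ∈ R → σ (end i) ≡ not (σ (prev (end i)))
      present-switch switch {i} i∈R = trans (switch i) (cong (_xor _) (dec-true (i ∈? R) i∈R))

      opposite-jumps : ∀ {i} → i ∈ R → - jump (tail i) ≡ jump (head i)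
      opposite-jumps {i} i∈R = begin
        - (sign (σ (prev (tail i))) - sign (σ (tail i)))
          ≡⟨ cong (λ b → - (sign b - sign (σ (tail i)))) prev-tail ⟩
        - (sign (not (σ (tail i))) - sign (σ (tail i)))
          ≡⟨ negate (sign (not (σ (tail i)))) (sign (σ (tail i))) ⟩
        sign (σ (tail i)) - sign (not (σ (tail i)))
          ≡⟨ cong₂ (λ a b → sign a - sign b) prev-head (sym (ends-differ i∈R)) ⟩
        sign (σ (prev (head i))) - sign (σ (head i)) ∎
        where
        open ≡-Reasoning
        negate : ∀ x y → - (x - y) ≡ y - x
        negate = solve-∀
        flip : ∀ {a b} → a ≡ not b → b ≡ not a
        flip {a} {b} a≡¬b = trans (sym (Bool.not-involutive b)) (cong not (sym a≡¬b))
        prev-tail : σ (prev (tail i)) ≡ not (σ (tail i))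
        prev-tail = flip (present-switch tail-switch i∈R)
        prev-head : σ (tail i) ≡ σ (prev (head i))
        prev-head = Bool.not-injective (trans (sym (ends-differ i∈R)) (present-switch head-switch i∈R))

      balanced-at : ∀ {i r} v → (i ∈ R → r ≡ jump v) → (i ∉ R → r ≡ 0ℤ) →
                    σ v ≡ does (i ∈? R) xor σ (prev v) → r +ℤ (sign (σ v) - sign (σ (prev v))) ≡ 0ℤ
      balanced-at {i} v present absent switch with i ∈? R
      ... | yes i∈R rewrite present i∈R = cancel (sign (σ (prev v))) (sign (σ v))
        where
        cancel : ∀ p a → p - a +ℤ (a - p) ≡ 0ℤ
        cancel = solve-∀
      ... | no  i∉R rewrite absent i∉R | switch =
        trans (ℤ.+-identityˡ _) (ℤ.+-inverseʳ (sign (σ (prev v))))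

    LadderFlow⇔Colouring : LadderFlow R ⇔ Σ (V → Bool) (Colouring R)
    LadderFlow⇔Colouring = mk⇔ (λ ψ → _ , LadderFlow⇒Colouring ψ) (Colouring⇒LadderFlow ∘ proj₂)

concatMap-cartesianProduct : ∀ {A B C : Set} (f : A × B → List C) xs ys →
                             concatMap f (cartesianProduct xs ys) ≡
                             concatMap (λ x → concatMap (λ y → f (x , y)) ys) xs
concatMap-cartesianProduct f []       ys = refl
concatMap-cartesianProduct f (x ∷ xs) ys =
  trans (List.concatMap-++ f (map (x ,_) ys) (cartesianProduct xs ys))
        (cong₂ _++_ (List.concatMap-map f (x ,_) ys) (concatMap-cartesianProduct f xs ys))

module CircularLadder (N : ℕ) (ℓ : Fin (suc N) → Fin 2 → ℕ) where

  Cell : Set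
  Cell = Fin (suc N) × Fin 2

  _≟C_ : DecidableEquality Cell
  _≟C_ = ×.≡-dec Fin._≟_ Fin._≟_

  forward backward : Cell → Cell
  forward  (i , s) = next i , s
  backward (i , s) = prev i , s

  cells : List Cell
  cells = cartesianProduct (allFin (suc N)) (allFin 2)

  cells-unique : Unique cells
  cells-unique = Unique.cartesianProduct⁺ (Unique.allFin⁺ (suc N)) (Unique.allFin⁺ 2)

  tail head : Fin (suc N) → Cell
  tail i = i , zero
  head i = i , suc zero

  tail-or-head : ∀ c → Σ (Fin (suc N)) (λ i → c ≡ tail i) ⊎ Σ (Fin (suc N)) (λ i → c ≡ head i)
  tail-or-head (i , zero)     = inj₁ (i , refl)
  tail-or-head (i , suc zero) = inj₂ (i , refl)

  open LadderFlows _≟C_ tail head (cong proj₁) (cong proj₁) (λ _ _ ()) tail-or-head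
                   forward backward
                   (λ (i , s) → cong (_, s) (prev-next i)) (λ (i , s) → cong (_, s) (next-prev i))
                   cells cells-unique (λ (i , s) → ∈-cartesianProduct⁺ (∈-allFin i) (∈-allFin s))
  open Subdivision (λ c → ℓ (proj₁ c) (proj₂ c)) forward _≟C_ (CL≟ (suc N) ℓ)

  colouring⇔switching : ∀ R → Σ (Cell → Bool) (Colouring R) ⇔
                              Σ (Fin (suc N) → Bool) (Switching (λ i → does (i ∈? R)))
  colouring⇔switching R = mk⇔ (λ (σ , χ) → (λ i → σ (i , zero)) , Colouring.tail-switch χ)
                              (λ (τ , switching) → colour τ , record
                                { tail-switch = switching
                                ; head-switch = λ i → not-switch (does (i ∈? R)) (switching i)
                                ; ends-differ = λ _ → refl })
    where
    colour : (Fin (suc N) → Bool) → Cell → Bool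
    colour τ (i , zero)     = τ i
    colour τ (i , suc zero) = not (τ i)
    not-switch : ∀ f {a b} → a ≡ f xor b → not a ≡ f xor not b
    not-switch false = cong not
    not-switch true  = cong not

  circular⇔even : ∀ R → Unique R →
                  Arcs.NZ3Flow (CL≟ (suc N) ℓ) (map (liftEdge ∘ rungEdge) R ++ CLrails (suc N) ℓ) ⇔
                  (odd (length R) ≡ false)
  circular⇔even R R-unique = begin
    Arcs.NZ3Flow (CL≟ (suc N) ℓ) (map (liftEdge ∘ rungEdge) R ++ CLrails (suc N) ℓ)
      ≈⟨ Arcs.≡⇒NZ3Flow (CL≟ (suc N) ℓ) (cong₂ _++_ (List.map-∘ R)
                           (sym (concatMap-cartesianProduct railPath (allFin (suc N)) (allFin 2)))) ⟩
    Arcs.NZ3Flow (CL≟ (suc N) ℓ) (map liftEdge (map rungEdge R) ++ concatMap railPath cells)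
      ≈⟨ subdivide (map rungEdge R) cells cells-unique ⟩
    Arcs.NZ3Flow _≟C_ (map rungEdge R ++ map railEdge cells)
      ≈⟨ NZ3Flow⇔LadderFlow R R-unique ⟩
    LadderFlow R
      ≈⟨ LadderFlow⇔Colouring R-unique ⟩
    Σ (Cell → Bool) (Colouring R)
      ≈⟨ colouring⇔switching R ⟩
    Σ (Fin (suc N) → Bool) (Switching (λ i → does (i ∈? R)))
      ≈⟨ switching⇔even (λ i → does (i ∈? R)) ⟩
    xorSum (λ i → does (i ∈? R)) ≡ false
      ≈⟨ mk⇔ (trans (sym (xorSum-∈ R R-unique))) (trans (xorSum-∈ R R-unique)) ⟩
    odd (length R) ≡ false
      ∎
    where open ⇔-Reasoning

module MobiusLadder (N : ℕ) (ℓ : Fin (suc N + suc N) → ℕ) where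

  Cell : Set
  Cell = Fin (suc N + suc N)

  tail head : Fin (suc N) → Cell
  tail i = i ↑ˡ suc N
  head i = suc N ↑ʳ i

  tail≢head : ∀ i j → tail i ≢ head j
  tail≢head i j tail≡head = ℕ.<⇒≢ (ℕ.<-≤-trans (Fin.toℕ<n i) (ℕ.m≤m+n (suc N) (toℕ j)))
                              (begin
                                toℕ i          ≡⟨ Fin.toℕ-↑ˡ i (suc N) ⟨
                                toℕ (tail i)   ≡⟨ cong toℕ tail≡head ⟩
                                toℕ (head j)   ≡⟨ Fin.toℕ-↑ʳ (suc N) j ⟩
                                suc N + toℕ j ∎)
    where open ≡-Reasoning

  tail-or-head : ∀ c → Σ (Fin (suc N)) (λ i → c ≡ tail i) ⊎ Σ (Fin (suc N)) (λ i → c ≡ head i)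
  tail-or-head c with splitAt (suc N) c in eq
  ... | inj₁ i = inj₁ (i , sym (Fin.splitAt⁻¹-↑ˡ eq))
  ... | inj₂ i = inj₂ (i , sym (Fin.splitAt⁻¹-↑ʳ eq))

  open LadderFlows Fin._≟_ tail head (Fin.↑ˡ-injective (suc N) _ _) (Fin.↑ʳ-injective (suc N) _ _)
                   tail≢head tail-or-head next prev prev-next next-prev
                   (allFin (suc N + suc N)) (Unique.allFin⁺ _) ∈-allFin
  open Subdivision ℓ next Fin._≟_ (ML≟ (suc N) ℓ)

  -- The flips of a colouring of the 2n-cycle: both ends of each present rung.
  flips : List (Fin (suc N)) → Cell → Bool
  flips R = [ present , present ]′ ∘ splitAt (suc N)
    where
    present : Fin (suc N) → Bool
    present i = does (i ∈? R)

  flips-tail : ∀ R i → flips R (tail i) ≡ does (i ∈? R)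
  flips-tail R i rewrite Fin.splitAt-↑ˡ (suc N) i (suc N) = refl

  flips-head : ∀ R i → flips R (head i) ≡ does (i ∈? R)
  flips-head R i rewrite Fin.splitAt-↑ʳ (suc N) (suc N) i = refl

  -- The two ends of a rung lie half way round the cycle from each other, and between
  -- them the colour switches at one end of every present rung.
  colouring⇔odd : ∀ R {i} → i ∈ R →
                  Σ (Cell → Bool) (Colouring R) ⇔ (xorSum (λ i → does (i ∈? R)) ≡ true)
  colouring⇔odd R {i} i∈R = mk⇔ present-odd colour
    where
    present : Fin (suc N) → Bool
    present i = does (i ∈? R)

    prefix-tail : ∀ j → prefixXor (flips R) (tail j) ≡ prefixXor present j
    prefix-tail j = trans (prefixXor-↑ˡ (suc N) (flips R) j) (prefixXor-cong (flips-tail R) j)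

    prefix-head : ∀ j → prefixXor (flips R) (head j) ≡ xorSum present xor prefixXor present j
    prefix-head j = trans (prefixXor-↑ʳ (suc N) (flips R) j)
                          (cong₂ _xor_ (xorSum-cong (flips-tail R)) (prefixXor-cong (flips-head R) j))

    switching : ∀ {σ} → Colouring R σ → Switching (flips R) σ
    switching {σ} χ c with tail-or-head c
    ... | inj₁ (j , refl) =
      trans (Colouring.tail-switch χ j) (cong (_xor σ (prev (tail j))) (sym (flips-tail R j)))
    ... | inj₂ (j , refl) =
      trans (Colouring.head-switch χ j) (cong (_xor σ (prev (head j))) (sym (flips-head R j)))

    present-odd : Σ (Cell → Bool) (Colouring R) → xorSum present ≡ true
    present-odd (σ , χ) = cancel (σ (tail i)) (xorSum present) (prefixXor present i) (begin
      not (σ (tail i)) xor (xorSum present xor prefixXor present i)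
        ≡⟨ cong₂ _xor_ (sym (Colouring.ends-differ χ i∈R)) (sym (prefix-head i)) ⟩
      σ (head i) xor prefixXor (flips R) (head i)
        ≡⟨ switching-invariant {f = flips R} (switching χ) (head i) ⟩
      σ zero xor flips R zero
        ≡⟨ switching-invariant {f = flips R} (switching χ) (tail i) ⟨
      σ (tail i) xor prefixXor (flips R) (tail i)
        ≡⟨ cong (σ (tail i) xor_) (prefix-tail i) ⟩
      σ (tail i) xor prefixXor present i ∎)
      where
      open ≡-Reasoning
      cancel : ∀ s x p → not s xor (x xor p) ≡ s xor p → x ≡ true
      cancel false false false ()
      cancel false false true  ()
      cancel false true  _     _ = refl
      cancel true  false false ()
      cancel true  false true  ()
      cancel true  true  _     _ = refl

    colour : xorSum present ≡ true → Σ (Cell → Bool) (Colouring R)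
    colour odd = prefixXor (flips R) , record
      { tail-switch = λ j → trans (prefix-switching (tail j))
                                  (cong (_xor prefixXor (flips R) (prev (tail j))) (flips-tail R j))
      ; head-switch = λ j → trans (prefix-switching (head j))
                                  (cong (_xor prefixXor (flips R) (prev (head j))) (flips-head R j))
      ; ends-differ = λ {j} _ → trans (prefix-head j)
                                      (trans (cong (_xor prefixXor present j) odd) (cong not (sym (prefix-tail j))))
      }
      where
      prefix-switching : Switching (flips R) (prefixXor (flips R))
      prefix-switching = prefixXor-switching (flips R) (begin
        xorSum (flips R)
          ≡⟨ xorSum-↑ (suc N) (flips R) ⟩
        xorSum (flips R ∘ tail) xor xorSum (flips R ∘ head)
          ≡⟨ cong₂ _xor_ (xorSum-cong (flips-tail R)) (xorSum-cong (flips-head R)) ⟩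
        xorSum present xor xorSum present
          ≡⟨ Bool.xor-same (xorSum present) ⟩
        false ∎)
        where open ≡-Reasoning

  möbius⇔odd : ∀ R → Unique R → ∀ {i} → i ∈ R →
               Arcs.NZ3Flow (ML≟ (suc N) ℓ) (map (liftEdge ∘ rungEdge) R ++ rails (GML (suc N) ℓ)) ⇔
               (odd (length R) ≡ true)
  möbius⇔odd R R-unique i∈R = begin
    Arcs.NZ3Flow (ML≟ (suc N) ℓ) (map (liftEdge ∘ rungEdge) R ++ concatMap railPath (allFin (suc N + suc N)))
      ≈⟨ Arcs.≡⇒NZ3Flow (ML≟ (suc N) ℓ) (cong (_++ rails (GML (suc N) ℓ)) (List.map-∘ R)) ⟩
    Arcs.NZ3Flow (ML≟ (suc N) ℓ) (map liftEdge (map rungEdge R) ++ concatMap railPath (allFin (suc N + suc N)))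
      ≈⟨ subdivide (map rungEdge R) (allFin (suc N + suc N)) (Unique.allFin⁺ _) ⟩
    Arcs.NZ3Flow Fin._≟_ (map rungEdge R ++ map railEdge (allFin (suc N + suc N)))
      ≈⟨ NZ3Flow⇔LadderFlow R R-unique ⟩
    LadderFlow R
      ≈⟨ LadderFlow⇔Colouring R-unique ⟩
    Σ (Cell → Bool) (Colouring R)
      ≈⟨ colouring⇔odd R i∈R ⟩
    xorSum (λ i → does (i ∈? R)) ≡ true
      ≈⟨ mk⇔ (trans (sym (xorSum-∈ R R-unique))) (trans (xorSum-∈ R R-unique)) ⟩
    odd (length R) ≡ true
      ∎
    where open ⇔-Reasoning

-- Deleting a rung

removeAt-++ : ∀ {A : Set} (xs ys : List A) k .(eq : length xs + length ys ≡ length (xs ++ ys)) →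
              removeAt (xs ++ ys) (cast eq (k ↑ˡ length ys)) ≡ removeAt xs k ++ ys
removeAt-++ (x ∷ xs) ys zero    eq = refl
removeAt-++ (x ∷ xs) ys (suc k) eq = cong (x ∷_) (removeAt-++ xs ys k (cong pred eq))

removeAt-map : ∀ {A B : Set} (f : A → B) xs (k : Fin (length (map f xs))) →
               Σ (Fin (length xs)) λ k′ → removeAt (map f xs) k ≡ map f (removeAt xs k′)
removeAt-map f (x ∷ xs) zero    = zero , refl
removeAt-map f (x ∷ xs) (suc k) =
  let k′ , removed = removeAt-map f xs k in suc k′ , cong (f x ∷_) removed

All-removeAt : ∀ {A : Set} {P : A → Set} {xs} → All P xs → ∀ k → All P (removeAt xs k)
All-removeAt (p ∷ ps) zero    = ps
All-removeAt (p ∷ ps) (suc k) = p ∷ All-removeAt ps k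

Unique-removeAt : ∀ {A : Set} {xs : List A} → Unique xs → ∀ k → Unique (removeAt xs k)
Unique-removeAt (x∉xs ∷ unique) zero    = unique
Unique-removeAt (x∉xs ∷ unique) (suc k) = All-removeAt x∉xs k ∷ Unique-removeAt unique k

odd-removeAt : ∀ {A : Set} (xs : List A) k → odd (length (removeAt xs k)) ≡ not (odd (length xs))
odd-removeAt xs k =
  trans (sym (Bool.not-involutive _)) (cong (not ∘ odd) (sym (List.length-removeAt′ xs k)))

exactly-one : ∀ {A B : Set} β b → A ⇔ (b ≡ β) → B ⇔ (not b ≡ β) → (A → ¬ B) × (¬ B → A)
exactly-one β b A⇔ B⇔ with b Bool.≟ β
... | yes refl = (λ _ y → Bool.not-¬ refl (sym (Equivalence.to B⇔ y)))
               , (λ _ → Equivalence.from A⇔ refl)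
... | no  b≢β  = (λ x → ⊥-elim (b≢β (Equivalence.to A⇔ x)))
               , (λ ¬y → ⊥-elim (¬y (Equivalence.from B⇔ (sym (Bool.¬-not (b≢β ∘ sym))))))

rung-deletion : ∀ {V : Set} (_≟_ : DecidableEquality V) {n} (e : Fin n → V × V) R rs β →
                Arcs.NZ3Flow _≟_ (map e R ++ rs) ⇔ (odd (length R) ≡ β) →
                (∀ k → Arcs.NZ3Flow _≟_ (map e (removeAt R k) ++ rs) ⇔
                       (odd (length (removeAt R k)) ≡ β)) →
                ∀ k → NZ3-rung-property (record { LV = V ; _≟L_ = _≟_ ; rungs = map e R ; rails = rs }) k
rung-deletion _≟_ e R rs β whole deleted k with k′ , removed ← removeAt-map e R k =
  exactly-one β (odd (length R))
    (begin
      HasNZFlow 3 (graph L)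
        ≈⟨ hasNZFlow⇔NZ3Flow (graph L) ⟩
      Arcs.NZ3Flow _≟_ (map e R ++ rs)
        ≈⟨ whole ⟩
      odd (length R) ≡ β
        ∎)
    (begin
      HasNZFlow 3 (graph L ─ rung L k)
        ≈⟨ hasNZFlow⇔NZ3Flow (graph L ─ rung L k) ⟩
      Arcs.NZ3Flow _≟_ (removeAt (map e R ++ rs) (rung L k))
        ≈⟨ Arcs.≡⇒NZ3Flow _≟_ (trans (removeAt-++ (map e R) rs k _) (cong (_++ rs) removed)) ⟩
      Arcs.NZ3Flow _≟_ (map e (removeAt R k′) ++ rs)
        ≈⟨ deleted k′ ⟩
      odd (length (removeAt R k′)) ≡ β
        ≈⟨ mk⇔ (trans (sym (odd-removeAt R k′))) (trans (odd-removeAt R k′)) ⟩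
      not (odd (length R)) ≡ β
        ∎)
  where
  open ⇔-Reasoning
  L : Ladder
  L = record { LV = _ ; _≟L_ = _≟_ ; rungs = map e R ; rails = rs }

GCL-rung-property : ∀ N ℓ R → Unique R → ∀ k → NZ3-rung-property (GCL (suc N) ℓ R) k
GCL-rung-property N ℓ R R-unique =
  rung-deletion (CL≟ (suc N) ℓ) _ R (CLrails (suc N) ℓ) false
    (circular⇔even R R-unique) (λ k → circular⇔even (removeAt R k) (Unique-removeAt R-unique k))
  where open CircularLadder N ℓ

GML-rung-property : ∀ N ℓ → ∀ k → NZ3-rung-property (GML (suc (suc N)) ℓ) k
GML-rung-property N ℓ =
  rung-deletion (ML≟ (suc (suc N)) ℓ) _ (allFin (suc (suc N))) (rails (GML (suc (suc N)) ℓ)) true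
    (möbius⇔odd (allFin _) (Unique.allFin⁺ _) (here refl))
    (λ k → möbius⇔odd (removeAt (allFin _) k) (Unique-removeAt (Unique.allFin⁺ _) k)
                      (proj₂ (remaining k)))
  where
  open MobiusLadder (suc N) ℓ
  remaining : ∀ k → Σ (Fin (suc (suc N))) (_∈ removeAt (allFin (suc (suc N))) k)
  remaining zero    = suc zero , here refl
  remaining (suc _) = zero , here refl

lemma3p2 : ((n : ℕ) (ℓ : Fin n → Fin 2 → ℕ) → 2 ≤ n →
             (k : Fin (length (rungs (GCL n ℓ (allFin n))))) →
             NZ3-rung-property (GCL n ℓ (allFin n)) k)
           × ((ℓ : Fin 2 → Fin 2 → ℕ) (i : Fin 2) →
             (k : Fin (length (rungs (GCL 2 ℓ (i ∷ []))))) →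
             NZ3-rung-property (GCL 2 ℓ (i ∷ [])) k)
           × ((n : ℕ) (ℓ : Fin (n + n) → ℕ) → 2 ≤ n →
             (k : Fin (length (rungs (GML n ℓ)))) →
             NZ3-rung-property (GML n ℓ) k)
lemma3p2 = (λ { (suc N) ℓ _ → GCL-rung-property N ℓ (allFin (suc N)) (Unique.allFin⁺ _) ; zero ℓ () })
         , (λ ℓ i → GCL-rung-property 1 ℓ (i ∷ []) ([] ∷ []))
         , (λ { (suc (suc N)) ℓ _ → GML-rung-property N ℓ ; (suc zero) ℓ (s≤s ()) })
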